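{- Every composition-free term $t$ satisfies condition $(\mathrm{LEN}_1)$: for every language valuation $\mathfrak{v}$ over any set $X$ and every non-empty word $w$ over $X$, if $w \in \hat{\mathfrak{v}}(t)$ then $\ell \in \hat{\mathfrak{v}}^{w}(t)$.
   Context: Let $\mathbf{V}$ be a set of variables. Terms are generated by $t, s ::= x \mid \mathrm{I} \mid \bot \mid t \cdot s \mid t \cup s \mid t^{*} \mid x^{ - }$ ($x \in \mathbf{V}$). A term is composition-free if neither composition $\cdot$ nor Kleene star $\_^{*}$ occurs in it. For a set $X$, a language valuation over $X$ is a map $\mathfrak{v}$ from variables to subsets of $X^{*}$ ($\mathrm{I}$ = empty word), extended to terms $\hat{\mathfrak{v}}$ by $\hat{\mathfrak{v}}(\mathrm{I}) = \{\mathrm{I}\}$, $\hat{\mathfrak{v}}(\bot) = \emptyset$, $\hat{\mathfrak{v}}(t\cdot s) = \{ab \mid a \in \hat{\mathfrak{v}}(t), b \in \hat{\mathfrak{v}}(s)\}$, $\hat{\mathfrak{v}}(t \cup s) = \hat{\mathfrak{v}}(t)\cup\hat{\mathfrak{v}}(s)$, $\hat{\mathfrak{v}}(t^{*}) = \hat{\mathfrak{v}}(t)^{*}$, $\hat{\mathfrak{v}}(x^{ - }) = X^{*} \setminus \mathfrak{v}(x)$. For a language valuation $\mathfrak{v}$ over $X$ and a word $w$ over $X$, $\mathfrak{v}^{w}$ is the language valuation over the one-letter set $\{\ell\}$ given by $\mathfrak{v}^{w}(x) = \{\mathrm{I} \mid \mathrm{I} \in \mathfrak{v}(x)\} \cup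 \{\ell \mid w \in \mathfrak{v}(x)\}$. -}

module Defs where

open import Data.List using (List; []; _∷_; _++_)
open import Data.Unit using (⊤; tt)
open import Data.Product using (Σ; _×_; _,_)
open import Data.Sum using (_⊎_)
open import Data.Empty using (⊥)
open import Relation.Nullary using (¬_)
open import Relation.Binary.PropositionalEquality using (_≡_)

data Term (V : Set) : Set where
  var  : V → Term V
  I    : Term V
  bot  : Term V
  _·_  : Term V → Term V → Term V
  _∪_  : Term V → Term V → Term V
  _*   : Term V → Term V
  _⁻   : V → Term V

data CompFree {V : Set} : Term V → Set where
  cf-var : ∀ x → CompFree (var x)
  cf-I   : CompFree I
  cf-bot : CompFree bot
  cf-∪   : ∀ {t s} → CompFree t → CompFree s → CompFree (t ∪ s)
  cf-⁻   : ∀ x → CompFree (x ⁻)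

Lang : Set → Set₁
Lang X = List X → Set

data Star {X : Set} (L : Lang X) : Lang X where
  star-nil  : Star L []
  star-cons : ∀ {a b} → L a → Star L b → Star L (a ++ b)

Valuation : Set → Set → Set₁
Valuation V X = V → Lang X

⟦_⟧ : {V X : Set} → Term V → Valuation V X → Lang X
⟦ var x ⟧ v w = v x w
⟦ I ⟧ v w = w ≡ []
⟦ bot ⟧ v w = ⊥
⟦ t · s ⟧ v w = Σ _ λ a → Σ _ λ b → w ≡ a ++ b × ⟦ t ⟧ v a × ⟦ s ⟧ v b
⟦ t ∪ s ⟧ v w = ⟦ t ⟧ v w ⊎ ⟦ s ⟧ v w
⟦ t * ⟧ v w = Star (⟦ t ⟧ v) w
⟦ x ⁻ ⟧ v w = ¬ (v x w)

ℓ : List ⊤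
ℓ = tt ∷ []

_^_ : {V X : Set} → Valuation V X → List X → Valuation V ⊤
(v ^ w) x u = (u ≡ [] × v x []) ⊎ (u ≡ ℓ × v x w)

NonEmpty : {X : Set} → List X → Set
NonEmpty w = ¬ (w ≡ [])

LEN₁ : {V : Set} → Term V → Set₁
LEN₁ {V} t = (X : Set) (v : Valuation V X) (w : List X) →
  NonEmpty w → ⟦ t ⟧ v w → ⟦ t ⟧ (v ^ w) ℓ

{-# OPTIONS --safe #-}
module Submission where

open import Data.List using (List)
open import Data.Product using (_,_)
open import Data.Sum using (inj₁; inj₂; [_,_]′)
open import Function using (_∘_; _⇔_; mk⇔; Equivalence)
open import Relation.Binary.PropositionalEquality using (refl)
open import Relation.Nullary using (contradiction)

open import Defs

ℓ∈v^w⇔w∈v : {V X : Set} (v : Valuation V X) (w : List X) (x : V) →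
            (v ^ w) x ℓ ⇔ v x w
ℓ∈v^w⇔w∈v v w x = mk⇔ [ (λ { (() , _) }) , (λ { (_ , w∈vx) → w∈vx }) ]′
                      (λ w∈vx → inj₂ (refl , w∈vx))

-- The complement case holds only because ℓ ≠ I: the I-part of v^w(x) cannot contain ℓ,
-- so ℓ ∈ v^w(x) reflects w ∈ v(x) in both directions.
lemma4p8 : {V : Set} (t : Term V) → CompFree t → LEN₁ t
lemma4p8 .(var x) (cf-var x) X v w w≢[] w∈vx = Equivalence.from (ℓ∈v^w⇔w∈v v w x) w∈vx
lemma4p8 .I cf-I X v w w≢[] w≡[] = contradiction w≡[] w≢[]
lemma4p8 .bot cf-bot X v w w≢[] ()
lemma4p8 (t ∪ s) (cf-∪ cf-t cf-s) X v w w≢[] =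
  [ inj₁ ∘ lemma4p8 t cf-t X v w w≢[] , inj₂ ∘ lemma4p8 s cf-s X v w w≢[] ]′
lemma4p8 .(x ⁻) (cf-⁻ x) X v w w≢[] w∉vx = w∉vx ∘ Equivalence.to (ℓ∈v^w⇔w∈v v w x)
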